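{- Let $n\ge 1$ and let $\pi=a_1a_2\cdots a_n$ be a permutation of $[n]=\{1,\dots,n\}$ in one-line notation. Let $\mathrm{rev}(\pi)$ be the number of indices $i\in\{1,\dots,n-1\}$ with $a_i>a_{i+1}$. Then the strip swap distance satisfies \[ \mathrm{SSD}(\pi)\ \ge\ \left\lceil \mathrm{rev}(\pi)/2 \right\rceil . \]
   Context: A strip of a permutation $\pi=a_1\cdots a_n$ of $[n]$ is a maximal contiguous substring $a_i a_{i+1}\cdots a_j$ of $\pi$ that is also a contiguous substring of the identity permutation $id_n=1\,2\,\cdots\,n$, i.e. a maximal run with $a_{k+1}=a_k+1$ for $i\le k<j$. Every permutation is thus partitioned into consecutive strips. A strip swap exchanges the positions of two strips of the current permutation, leaving all other entries in their relative places. The strip swap distance $\mathrm{SSD}(\pi)$ is the minimum number $m$ such that some sequence of $m$ strip swaps, applied successively (strips being recomputed after each swap), transforms $\pi$ into $id_n$. -}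

module Defs where

open import Data.Nat using (ℕ; zero; suc; _<ᵇ_; _≡ᵇ_)
open import Data.List using (List; []; _∷_; _++_; concat; map; upTo; [_])
open import Data.Bool using (if_then_else_)
open import Data.Product using (∃-syntax; _×_)
open import Relation.Binary.PropositionalEquality using (_≡_)

idPerm : ℕ → List ℕ
idPerm n = map suc (upTo n)

rev : List ℕ → ℕ
rev [] = 0
rev (x ∷ []) = 0
rev (x ∷ y ∷ xs) = (if y <ᵇ x then 1 else 0) Data.Nat.+ rev (y ∷ xs)

insStrip : ℕ → List (List ℕ) → List (List ℕ)
insStrip x [] = (x ∷ []) ∷ []
insStrip x ([] ∷ bs) = (x ∷ []) ∷ [] ∷ bs
insStrip x ((y ∷ b) ∷ bs) =
  if suc x ≡ᵇ y then (x ∷ y ∷ b) ∷ bs else (x ∷ []) ∷ (y ∷ b) ∷ bs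

-- partition of a list into its strips: maximal runs with a_{k+1} = a_k + 1
strips : List ℕ → List (List ℕ)
strips [] = []
strips (x ∷ xs) = insStrip x (strips xs)

StripSwap : List ℕ → List ℕ → Set
StripSwap π ρ =
  ∃[ A ] ∃[ B ] ∃[ C ] ∃[ x ] ∃[ y ]
    (strips π ≡ A ++ [ x ] ++ B ++ [ y ] ++ C)
    × (ρ ≡ concat (A ++ [ y ] ++ B ++ [ x ] ++ C))

data Reach : ℕ → List ℕ → List ℕ → Set where
  done : ∀ {π} → Reach zero π π
  step : ∀ {m π ρ σ} → StripSwap π ρ → Reach m ρ σ → Reach (suc m) π σ

-- Only the descents at the (at most four) junctions around the swapped nonempty
-- blocks X = x₁…x₂ and Y = y₁…y₂ can change.  By transitivity of <, each old
-- junction descent is paid for by the corresponding new one plus a descent between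
-- x₁ and y₁ or between x₂ and y₂, and x₁ > y₁, y₁ > x₁ cannot both hold (likewise
-- for the tails); for adjacent blocks, a chain y₂ > x₂ > y₁ > x₁ yields the new
-- descent y₂ > x₁.  So a swap lowers rev by at most two, and as the identity has no
-- descents, reaching it in m swaps forces rev π ≤ 2m.
module Submission where

open import Defs
open import Data.Bool using (true; false; if_then_else_)
open import Data.Empty using (⊥-elim)
open import Data.List using (List; []; _∷_; _++_; [_]; concat; head; last)
open import Data.List.Properties using (concat-++)
open import Data.List.Relation.Binary.Permutation.Propositional using (_↭_)
open import Data.List.Relation.Unary.All as All using (All; []; _∷_)
open import Data.List.Relation.Unary.All.Properties using (++⁻ʳ)
open import Data.List.Relation.Unary.Linked using (Linked; []; [-]; _∷_)
open import Data.List.Relation.Unary.Linked.Properties using (map⁺; applyUpTo⁺₂)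
open import Data.Maybe using (Maybe; just; nothing)
open import Data.Nat using (ℕ; suc; _+_; _≤_; _<_; _<?_; _<ᵇ_; _≡ᵇ_; ⌈_/2⌉; z≤n; s≤s)
open import Data.Nat.Properties
open import Data.Nat.Tactic.RingSolver using (solve-∀)
open import Data.Product using (∃-syntax; _,_)
open import Function using (id)
open import Relation.Binary.PropositionalEquality
  using (_≡_; _≢_; refl; sym; trans; cong; subst)
open import Relation.Nullary.Decidable using (yes; no)
open import Relation.Nullary.Reflects using (ofʸ; ofⁿ)

descent : ℕ → ℕ → ℕ
descent x y = if y <ᵇ x then 1 else 0

descentᴹ : Maybe ℕ → Maybe ℕ → ℕ
descentᴹ (just x) (just y) = descent x y
descentᴹ _        _        = 0

junction : List ℕ → List ℕ → ℕ
junction u v = descentᴹ (last u) (head v)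

descent≡1 : ∀ {x y} → y < x → descent x y ≡ 1
descent≡1 {x} {y} y<x with y <ᵇ x | <ᵇ-reflects-< y x
... | true  | _       = refl
... | false | ofⁿ y≮x = ⊥-elim (y≮x y<x)

descent≡0 : ∀ {x y} → x ≤ y → descent x y ≡ 0
descent≡0 {x} {y} x≤y with y <ᵇ x | <ᵇ-reflects-< y x
... | true  | ofʸ y<x = ⊥-elim (<⇒≱ y<x x≤y)
... | false | _       = refl

descent≤1 : ∀ x y → descent x y ≤ 1
descent≤1 x y with y <ᵇ x
... | true  = ≤-refl
... | false = z≤n

descent-antisym : ∀ x y → descent x y + descent y x ≤ 1
descent-antisym x y with y <? x
... | no y≮x  rewrite descent≡0 (≮⇒≥ y≮x) = descent≤1 y x
... | yes y<x rewrite descent≡0 (<⇒≤ y<x) = +-mono-≤ (descent≤1 x y) (z≤n {0})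

descent-trans : ∀ x y z → descent x z ≤ descent x y + descent y z
descent-trans x y z with z <? x
... | no z≮x rewrite descent≡0 (≮⇒≥ z≮x) = z≤n
... | yes z<x rewrite descent≡1 z<x with y <? x
...   | yes y<x rewrite descent≡1 y<x = s≤s z≤n
...   | no y≮x  rewrite descent≡1 (<-≤-trans z<x (≮⇒≥ y≮x)) = m≤n+m 1 _

descent-path₃ : ∀ w x y z → descent w x + descent x y + descent y z ≤ 2 + descent w z
descent-path₃ w x y z with z <? w
... | yes z<w rewrite descent≡1 z<w =
  +-mono-≤ (+-mono-≤ (descent≤1 w x) (descent≤1 x y)) (descent≤1 y z)
... | no z≮w rewrite descent≡0 (≮⇒≥ z≮w) with x <? w | y <? x | z <? y
...   | no x≮w | _ | _ rewrite descent≡0 (≮⇒≥ x≮w) =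
  +-mono-≤ (descent≤1 x y) (descent≤1 y z)
...   | _ | no y≮x | _ rewrite descent≡0 (≮⇒≥ y≮x) =
  +-mono-≤ (+-mono-≤ (descent≤1 w x) (z≤n {0})) (descent≤1 y z)
...   | _ | _ | no z≮y rewrite descent≡0 (≮⇒≥ z≮y) =
  +-mono-≤ (+-mono-≤ (descent≤1 w x) (descent≤1 x y)) (z≤n {0})
...   | yes x<w | yes y<x | yes z<y = ⊥-elim (z≮w (<-trans z<y (<-trans y<x x<w)))

descentᴹ-trans : ∀ u y w → descentᴹ u w ≤ descentᴹ u (just y) + descentᴹ (just y) w
descentᴹ-trans (just x) y (just z) = descent-trans x y z
descentᴹ-trans (just x) y nothing  = z≤n
descentᴹ-trans nothing  y w        = z≤n

descent-adjacent-swap : ∀ a x₁ x₂ y₁ y₂ c →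
  descentᴹ a (just x₁) + descent x₂ y₁ + descentᴹ (just y₂) c
    ≤ descentᴹ a (just y₁) + descent y₂ x₁ + descentᴹ (just x₂) c + 2
descent-adjacent-swap a x₁ x₂ y₁ y₂ c = begin
  descentᴹ a (just x₁) + descent x₂ y₁ + descentᴹ (just y₂) c
    ≤⟨ +-mono-≤ (+-monoˡ-≤ _ (descentᴹ-trans a y₁ (just x₁)))
                (descentᴹ-trans (just y₂) x₂ c) ⟩
  left + descent y₁ x₁ + descent x₂ y₁ + (descent y₂ x₂ + right)
    ≡⟨ regroup left (descent y₁ x₁) (descent x₂ y₁) (descent y₂ x₂) right ⟩
  left + right + (descent y₂ x₂ + descent x₂ y₁ + descent y₁ x₁)
    ≤⟨ +-monoʳ-≤ (left + right) (descent-path₃ y₂ x₂ y₁ x₁) ⟩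
  left + right + (2 + descent y₂ x₁)
    ≡⟨ ungroup left right (descent y₂ x₁) ⟩
  left + descent y₂ x₁ + right + 2 ∎
  where
  open ≤-Reasoning
  left right : ℕ
  left  = descentᴹ a (just y₁)
  right = descentᴹ (just x₂) c
  regroup : ∀ l p q r s → l + p + q + (r + s) ≡ l + s + (r + q + p)
  regroup = solve-∀
  ungroup : ∀ l s e → l + s + (2 + e) ≡ l + e + s + 2
  ungroup = solve-∀

descent-separated-swap : ∀ a x₁ x₂ q b y₁ y₂ c →
  descentᴹ a (just x₁) + descent x₂ q + descent b y₁ + descentᴹ (just y₂) c
    ≤ descentᴹ a (just y₁) + descent y₂ q + descent b x₁ + descentᴹ (just x₂) c + 2
descent-separated-swap a x₁ x₂ q b y₁ y₂ c = begin
  descentᴹ a (just x₁) + descent x₂ q + descent b y₁ + descentᴹ (just y₂) c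
    ≤⟨ +-mono-≤ (+-mono-≤ (+-mono-≤ (descentᴹ-trans a y₁ (just x₁))
                                     (descent-trans x₂ y₂ q))
                          (descent-trans b x₁ y₁))
                (descentᴹ-trans (just y₂) x₂ c) ⟩
  (left + descent y₁ x₁) + (descent x₂ y₂ + descent y₂ q)
    + (descent b x₁ + descent x₁ y₁) + (descent y₂ x₂ + right)
    ≡⟨ regroup left (descent y₁ x₁) (descent x₂ y₂) (descent y₂ q)
               (descent b x₁) (descent x₁ y₁) (descent y₂ x₂) right ⟩
  left + descent y₂ q + descent b x₁ + right
    + ((descent x₁ y₁ + descent y₁ x₁) + (descent x₂ y₂ + descent y₂ x₂))
    ≤⟨ +-monoʳ-≤ _ (+-mono-≤ (descent-antisym x₁ y₁) (descent-antisym x₂ y₂)) ⟩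
  left + descent y₂ q + descent b x₁ + right + 2 ∎
  where
  open ≤-Reasoning
  left right : ℕ
  left  = descentᴹ a (just y₁)
  right = descentᴹ (just x₂) c
  regroup : ∀ l p₁ p₂ p₃ p₄ p₅ p₆ r →
    l + p₁ + (p₂ + p₃) + (p₄ + p₅) + (p₆ + r)
      ≡ l + p₃ + p₄ + r + ((p₅ + p₁) + (p₂ + p₆))
  regroup = solve-∀

rev-++ : ∀ u v → rev (u ++ v) ≡ rev u + junction u v + rev v
rev-++ []           v       = refl
rev-++ (x ∷ [])     []      = refl
rev-++ (x ∷ [])     (y ∷ v) = refl
rev-++ (x ∷ y ∷ u)  v       =
  trans (cong (descent x y +_) (rev-++ (y ∷ u) v))
        (reassoc (descent x y) (rev (y ∷ u)) (junction (y ∷ u) v) (rev v))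
  where
  reassoc : ∀ a b c d → a + (b + c + d) ≡ a + b + c + d
  reassoc = solve-∀

last-∷ : ∀ (x : ℕ) xs → ∃[ y ] last (x ∷ xs) ≡ just y
last-∷ x []       = x , refl
last-∷ x (y ∷ xs) = last-∷ y xs

junction-adjacent-swap : ∀ P x₁ xs y₁ ys R →
  junction P (x₁ ∷ xs) + junction (x₁ ∷ xs) (y₁ ∷ ys) + junction (y₁ ∷ ys) R
    ≤ junction P (y₁ ∷ ys) + junction (y₁ ∷ ys) (x₁ ∷ xs) + junction (x₁ ∷ xs) R + 2
junction-adjacent-swap P x₁ xs y₁ ys R with last-∷ x₁ xs | last-∷ y₁ ys
... | x₂ , lastX | y₂ , lastY rewrite lastX | lastY =
  descent-adjacent-swap (last P) x₁ x₂ y₁ y₂ (head R)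

junction-separated-swap : ∀ P x₁ xs q qs y₁ ys R →
  junction P (x₁ ∷ xs) + junction (x₁ ∷ xs) (q ∷ qs)
    + junction (q ∷ qs) (y₁ ∷ ys) + junction (y₁ ∷ ys) R
    ≤ junction P (y₁ ∷ ys) + junction (y₁ ∷ ys) (q ∷ qs)
      + junction (q ∷ qs) (x₁ ∷ xs) + junction (x₁ ∷ xs) R + 2
junction-separated-swap P x₁ xs q qs y₁ ys R
  with last-∷ x₁ xs | last-∷ q qs | last-∷ y₁ ys
... | x₂ , lastX | b , lastQ | y₂ , lastY rewrite lastX | lastQ | lastY =
  descent-separated-swap (last P) x₁ x₂ q b y₁ y₂ (head R)

rev-++-adjacent : ∀ P x xs y ys R →
  rev (P ++ (x ∷ xs) ++ (y ∷ ys) ++ R)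
    ≡ rev P + rev R + (rev (x ∷ xs) + rev (y ∷ ys))
      + (junction P (x ∷ xs) + junction (x ∷ xs) (y ∷ ys) + junction (y ∷ ys) R)
rev-++-adjacent P x xs y ys R
  rewrite rev-++ P ((x ∷ xs) ++ (y ∷ ys) ++ R)
        | rev-++ (x ∷ xs) ((y ∷ ys) ++ R)
        | rev-++ (y ∷ ys) R =
  shuffle (rev P) (junction P (x ∷ xs)) (rev (x ∷ xs)) (junction (x ∷ xs) (y ∷ ys))
          (rev (y ∷ ys)) (junction (y ∷ ys) R) (rev R)
  where
  shuffle : ∀ p j₁ a j₂ b j₃ r →
    p + j₁ + (a + j₂ + (b + j₃ + r)) ≡ p + r + (a + b) + (j₁ + j₂ + j₃)
  shuffle = solve-∀

rev-++-separated : ∀ P x xs q qs y ys R →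
  rev (P ++ (x ∷ xs) ++ (q ∷ qs) ++ (y ∷ ys) ++ R)
    ≡ rev P + rev (q ∷ qs) + rev R + (rev (x ∷ xs) + rev (y ∷ ys))
      + (junction P (x ∷ xs) + junction (x ∷ xs) (q ∷ qs)
         + junction (q ∷ qs) (y ∷ ys) + junction (y ∷ ys) R)
rev-++-separated P x xs q qs y ys R
  rewrite rev-++ P ((x ∷ xs) ++ (q ∷ qs) ++ (y ∷ ys) ++ R)
        | rev-++ (x ∷ xs) ((q ∷ qs) ++ (y ∷ ys) ++ R)
        | rev-++ (q ∷ qs) ((y ∷ ys) ++ R)
        | rev-++ (y ∷ ys) R =
  shuffle (rev P) (junction P (x ∷ xs)) (rev (x ∷ xs)) (junction (x ∷ xs) (q ∷ qs))
          (rev (q ∷ qs)) (junction (q ∷ qs) (y ∷ ys))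
          (rev (y ∷ ys)) (junction (y ∷ ys) R) (rev R)
  where
  shuffle : ∀ p j₁ a j₂ c j₃ b j₄ r →
    p + j₁ + (a + j₂ + (c + j₃ + (b + j₄ + r)))
      ≡ p + c + r + (a + b) + (j₁ + j₂ + j₃ + j₄)
  shuffle = solve-∀

≤-from-swapped-expansions : ∀ {old new j j′} s a b →
  old ≡ s + (a + b) + j → new ≡ s + (b + a) + j′ → j ≤ j′ + 2 → old ≤ new + 2
≤-from-swapped-expansions {j = j} {j′} s a b refl refl j≤j′+2 = begin
  s + (a + b) + j        ≤⟨ +-monoʳ-≤ (s + (a + b)) j≤j′+2 ⟩
  s + (a + b) + (j′ + 2) ≡⟨ cong (λ t → s + t + (j′ + 2)) (+-comm a b) ⟩
  s + (b + a) + (j′ + 2) ≡⟨ sym (+-assoc (s + (b + a)) j′ 2) ⟩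
  s + (b + a) + j′ + 2   ∎
  where open ≤-Reasoning

rev-swap-blocks : ∀ P X Q Y R → X ≢ [] → Y ≢ [] →
  rev (P ++ X ++ Q ++ Y ++ R) ≤ rev (P ++ Y ++ Q ++ X ++ R) + 2
rev-swap-blocks P []       Q Y        R X≢[] _    = ⊥-elim (X≢[] refl)
rev-swap-blocks P (_ ∷ _)  Q []       R _    Y≢[] = ⊥-elim (Y≢[] refl)
rev-swap-blocks P (x ∷ xs) [] (y ∷ ys) R _ _ =
  ≤-from-swapped-expansions (rev P + rev R) (rev (x ∷ xs)) (rev (y ∷ ys))
    (rev-++-adjacent P x xs y ys R) (rev-++-adjacent P y ys x xs R)
    (junction-adjacent-swap P x xs y ys R)
rev-swap-blocks P (x ∷ xs) (q ∷ qs) (y ∷ ys) R _ _ =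
  ≤-from-swapped-expansions (rev P + rev (q ∷ qs) + rev R) (rev (x ∷ xs)) (rev (y ∷ ys))
    (rev-++-separated P x xs q qs y ys R) (rev-++-separated P y ys q qs x xs R)
    (junction-separated-swap P x xs q qs y ys R)

concat-insStrip : ∀ x ss → concat (insStrip x ss) ≡ x ∷ concat ss
concat-insStrip x []             = refl
concat-insStrip x ([] ∷ ss)      = refl
concat-insStrip x ((y ∷ s) ∷ ss) with suc x ≡ᵇ y
... | true  = refl
... | false = refl

concat-strips : ∀ l → concat (strips l) ≡ l
concat-strips []      = refl
concat-strips (x ∷ l) = trans (concat-insStrip x (strips l)) (cong (x ∷_) (concat-strips l))

insStrip-nonempty : ∀ x ss → All (_≢ []) ss → All (_≢ []) (insStrip x ss)
insStrip-nonempty x []             _ = (λ ()) ∷ []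
insStrip-nonempty x ([] ∷ ss)      h = (λ ()) ∷ h
insStrip-nonempty x ((y ∷ s) ∷ ss) (_ ∷ h) with suc x ≡ᵇ y
... | true  = (λ ()) ∷ h
... | false = (λ ()) ∷ (λ ()) ∷ h

strips-nonempty : ∀ l → All (_≢ []) (strips l)
strips-nonempty []      = []
strips-nonempty (x ∷ l) = insStrip-nonempty x (strips l) (strips-nonempty l)

concat-blocks : ∀ (A : List (List ℕ)) x B y C →
  concat (A ++ [ x ] ++ B ++ [ y ] ++ C) ≡ concat A ++ x ++ concat B ++ y ++ concat C
concat-blocks A x B y C =
  trans (sym (concat-++ A _)) (cong (λ t → concat A ++ x ++ t) (sym (concat-++ B _)))

rev-stripSwap : ∀ {π ρ} → StripSwap π ρ → rev π ≤ rev ρ + 2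
rev-stripSwap {π} (A , B , C , x , y , π-strips , refl) = begin
  rev π
    ≡⟨ cong rev π-blocks ⟩
  rev (concat A ++ x ++ concat B ++ y ++ concat C)
    ≤⟨ rev-swap-blocks (concat A) x (concat B) y (concat C) x≢[] y≢[] ⟩
  rev (concat A ++ y ++ concat B ++ x ++ concat C) + 2
    ≡⟨ cong (λ σ → rev σ + 2) (sym (concat-blocks A y B x C)) ⟩
  rev (concat (A ++ [ y ] ++ B ++ [ x ] ++ C)) + 2
    ∎
  where
  open ≤-Reasoning
  π-blocks : π ≡ concat A ++ x ++ concat B ++ y ++ concat C
  π-blocks = trans (sym (concat-strips π))
                   (trans (cong concat π-strips) (concat-blocks A x B y C))
  nonempty : All (_≢ []) (A ++ [ x ] ++ B ++ [ y ] ++ C)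
  nonempty = subst (All (_≢ [])) π-strips (strips-nonempty π)
  x≢[] : x ≢ []
  x≢[] = All.head (++⁻ʳ A nonempty)
  y≢[] : y ≢ []
  y≢[] = All.head (++⁻ʳ B (All.tail (++⁻ʳ A nonempty)))

rev-reach : ∀ {m π σ} → Reach m π σ → rev π ≤ rev σ + (m + m)
rev-reach {σ = σ} done = m≤m+n (rev σ) 0
rev-reach {suc m} {π} {σ} (step {ρ = ρ} swap rest) = begin
  rev π                     ≤⟨ rev-stripSwap {π} swap ⟩
  rev ρ + 2                 ≤⟨ +-monoˡ-≤ 2 (rev-reach rest) ⟩
  rev σ + (m + m) + 2       ≡⟨ two-more-steps (rev σ) m ⟩
  rev σ + (suc m + suc m)   ∎
  where
  open ≤-Reasoning
  two-more-steps : ∀ r m → r + (m + m) + 2 ≡ r + (suc m + suc m)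
  two-more-steps = solve-∀

rev-ascending : ∀ {l} → Linked _≤_ l → rev l ≡ 0
rev-ascending []                  = refl
rev-ascending [-]                 = refl
rev-ascending (x≤y ∷ ascending) rewrite descent≡0 x≤y = rev-ascending ascending

idPerm-ascending : ∀ n → Linked _≤_ (idPerm n)
idPerm-ascending n = map⁺ (applyUpTo⁺₂ id n (λ i → n≤1+n (suc i)))

lemma1 : (n : ℕ) → 1 ≤ n → (π : List ℕ) → π ↭ idPerm n →
    (m : ℕ) → Reach m π (idPerm n) → ⌈ rev π /2⌉ ≤ m
lemma1 n _ π _ m π↝id = begin
  ⌈ rev π /2⌉   ≤⟨ ⌈n/2⌉-mono rev-π≤2m ⟩
  ⌈ m + m /2⌉   ≡⟨ sym (n≡⌈n+n/2⌉ m) ⟩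
  m             ∎
  where
  open ≤-Reasoning
  rev-π≤2m : rev π ≤ m + m
  rev-π≤2m = subst (λ r → rev π ≤ r + (m + m))
                   (rev-ascending (idPerm-ascending n)) (rev-reach π↝id)
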